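{- If $P$ is the Petersen graph, then $\mathrm{H}(P)=6$.
   Context: All graphs are finite, simple and undirected; $N(v)$ is the open neighborhood of $v$. Vertices are colored blue or white. Under the hopping color change rule, a blue vertex $v$ may force a white vertex $w$ (not necessarily adjacent to $v$) to become blue provided $v$ has not previously performed a force and every vertex of $N(v)$ is blue. Starting from an initial blue set $B\subseteq V(G)$, forces are applied one at a time until no further force is possible; $B$ is a hopping forcing set if some such sequence turns every vertex blue. $\mathrm{H}(G)$ is the minimum size of a hopping forcing set of $G$. -}

module Defs where

open import Data.Nat using (ℕ; _≤_)
open import Data.Bool using (Bool; true; false; _∨_; _∧_)
open import Data.Fin using (Fin; toℕ)
open import Data.Fin.Subset using (Subset; _∈_; _∉_; ⁅_⁆; _∪_; ⊤; ∣_∣)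
open import Data.Nat using (_≡ᵇ_)
open import Data.List using (List; []; _∷_)
open import Data.Bool.ListAction using (any)
open import Data.Product using (Σ; _×_; _,_; ∃)
open import Relation.Binary.PropositionalEquality using (_≡_)

-- A finite simple graph on vertex set Fin n, given by a Boolean adjacency relation
-- (the instance used below, the Petersen graph, is symmetric and loopless).
record Graph (n : ℕ) : Set where
  field
    adj : Fin n → Fin n → Bool
open Graph public

NbhdBlue : ∀ {n} → Graph n → Subset n → Fin n → Set
NbhdBlue G B v = ∀ u → adj G v u ≡ true → u ∈ B

-- A state of the process: (blue set, set of vertices that have already forced).
data Force {n} (G : Graph n) : Subset n × Subset n → Subset n × Subset n → Set where
  force : ∀ {B F} (v w : Fin n) → v ∈ B → v ∉ F → NbhdBlue G B v → w ∉ B →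
          Force G (B , F) (B ∪ ⁅ w ⁆ , F ∪ ⁅ v ⁆)

data Forces {n} (G : Graph n) : Subset n × Subset n → Subset n × Subset n → Set where
  done : ∀ {s} → Forces G s s
  step : ∀ {s t u} → Force G s t → Forces G t u → Forces G s u

IsHoppingForcingSet : ∀ {n} → Graph n → Subset n → Set
IsHoppingForcingSet {n} G B = ∃ λ F → Forces G (B , Data.Fin.Subset.⊥) (⊤ , F)

HoppingForcingNumberIs : ∀ {n} → Graph n → ℕ → Set
HoppingForcingNumberIs {n} G k =
  (Σ (Subset n) λ B → IsHoppingForcingSet G B × ∣ B ∣ ≡ k) ×
  (∀ (B : Subset n) → IsHoppingForcingSet G B → k ≤ ∣ B ∣)

-- Petersen graph: outer 5-cycle 0-1-2-3-4-0, inner pentagram 5-7-9-6-8-5,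
-- spokes i — i+5.
petersenEdges : List (ℕ × ℕ)
petersenEdges =
  (0 , 1) ∷ (1 , 2) ∷ (2 , 3) ∷ (3 , 4) ∷ (4 , 0) ∷
  (5 , 7) ∷ (7 , 9) ∷ (9 , 6) ∷ (6 , 8) ∷ (8 , 5) ∷
  (0 , 5) ∷ (1 , 6) ∷ (2 , 7) ∷ (3 , 8) ∷ (4 , 9) ∷ []

petersenAdj : Fin 10 → Fin 10 → Bool
petersenAdj u v = any match petersenEdges
  where
  match : ℕ × ℕ → Bool
  match (a , b) = ((toℕ u ≡ᵇ a) ∧ (toℕ v ≡ᵇ b)) ∨ ((toℕ u ≡ᵇ b) ∧ (toℕ v ≡ᵇ a))

Petersen : Graph 10
Petersen = record { adj = petersenAdj }

-- A vertex that forces must be blue with all its neighbours blue, i.e. lie in the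
-- interior of the current blue set, and it never forces again; meanwhile every force
-- adds exactly one blue vertex. So once the blue set has k vertices, k − |B₀| distinct
-- forcers already sit in its interior, and another force needs one more. In the
-- Petersen graph every 7-vertex set has at most two interior vertices (girth 5 gives
-- any three white vertices at least five blue neighbours), so a forcing set of size at
-- most 5 gets stuck at 7 blue vertices. Conversely the outer 5-cycle together with
-- vertex 5 is a forcing set: vertices 0, 1, 2, 3 in turn become interior and hop to
-- 6, 7, 8, 9.
{-# OPTIONS --safe #-}
module Submission where

open import Defs
open import Data.Nat using (suc; _+_; _≤_; _<_; _≤?_; _<?_; s<s⁻¹)
import Data.Nat.Properties as ℕ
open import Data.Bool using (true)
open import Data.Bool.Properties using () renaming (_≟_ to _≟ᵇ_)
open import Data.Fin using (zero; suc; #_)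
open import Data.Fin.Properties using (all?)
open import Data.Fin.Subset
  using (Subset; _∈_; _∉_; _⊆_; ⁅_⁆; _∪_; ⊤; ∣_∣; inside; outside)
open import Data.Fin.Subset.Properties
  using (_∈?_; anySubset?; ∣⊤∣≡n; p⊂q⇒∣p∣<∣q∣; p⊆p∪q; x∈p∪q⁻; x∈⁅y⁆⇒x≡y; ∪-identityʳ; ∣⊥∣≡0; ⊥⊆)
open import Data.Vec using ([]; _∷_; tabulate; here; there)
open import Data.Vec.Properties using (lookup∘tabulate; []=⇒lookup; lookup⇒[]=)
open import Data.Product using (∃; _×_; _,_)
open import Data.Sum using (inj₁; inj₂)
open import Function using (_∘_)
open import Relation.Nullary using (¬_; does; contradiction)
open import Relation.Nullary.Decidable
  using (Dec; yes; no; True; False; _×-dec_; _→-dec_; dec-true; toWitness; toWitnessFalse; from-yes; from-no)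
open import Relation.Unary using (Decidable)
open import Relation.Binary.PropositionalEquality using (_≡_; refl; sym; trans; cong; subst)

nbhdBlue? : ∀ {n} (G : Graph n) B → Decidable (NbhdBlue G B)
nbhdBlue? G B v = all? λ u → adj G v u ≟ᵇ true →-dec u ∈? B

interior : ∀ {n} → Graph n → Subset n → Subset n
interior G B = tabulate λ v → does (v ∈? B ×-dec nbhdBlue? G B v)

module _ {n} (G : Graph n) (B : Subset n) where

  ∈-interior⁺ : ∀ {v} → v ∈ B → NbhdBlue G B v → v ∈ interior G B
  ∈-interior⁺ {v} v∈B blue = lookup⇒[]= v _
    (trans (lookup∘tabulate _ v) (dec-true (v ∈? B ×-dec nbhdBlue? G B v) (v∈B , blue)))

  ∈-interior⁻ : ∀ {v} → v ∈ interior G B → v ∈ B × NbhdBlue G B v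
  ∈-interior⁻ {v} v∈I =
    does-true (v ∈? B ×-dec nbhdBlue? G B v) (trans (sym (lookup∘tabulate _ v)) ([]=⇒lookup v∈I))
    where
    does-true : ∀ {a} {A : Set a} (a? : Dec A) → does a? ≡ true → A
    does-true (yes a) _ = a

interior-mono : ∀ {n} (G : Graph n) {B B′} → B ⊆ B′ → interior G B ⊆ interior G B′
interior-mono G {B} {B′} B⊆B′ v∈I with ∈-interior⁻ G B v∈I
... | v∈B , blue = ∈-interior⁺ G B′ (B⊆B′ v∈B) (λ u uv → B⊆B′ (blue u uv))

∣p∪⁅x⁆∣≡1+∣p∣ : ∀ {n} {p : Subset n} {x} → x ∉ p → ∣ p ∪ ⁅ x ⁆ ∣ ≡ suc ∣ p ∣
∣p∪⁅x⁆∣≡1+∣p∣ {p = inside  ∷ p} {zero}  x∉p = contradiction here x∉p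
∣p∪⁅x⁆∣≡1+∣p∣ {p = outside ∷ p} {zero}  _   = cong (suc ∘ ∣_∣) (∪-identityʳ p)
∣p∪⁅x⁆∣≡1+∣p∣ {p = inside  ∷ p} {suc x} x∉p = cong suc (∣p∪⁅x⁆∣≡1+∣p∣ (x∉p ∘ there))
∣p∪⁅x⁆∣≡1+∣p∣ {p = outside ∷ p} {suc x} x∉p = ∣p∪⁅x⁆∣≡1+∣p∣ (x∉p ∘ there)

module _ {n} (G : Graph n) where

  forcers⊆interior-step : ∀ {B F B′ F′} → Force G (B , F) (B′ , F′) →
                          F ⊆ interior G B → F′ ⊆ interior G B′
  forcers⊆interior-step {F = F} (force v w v∈B _ blue _) F⊆I x∈F′ with x∈p∪q⁻ F ⁅ v ⁆ x∈F′
  ... | inj₁ x∈F = interior-mono G (p⊆p∪q ⁅ w ⁆) (F⊆I x∈F)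
  ... | inj₂ x∈⁅v⁆ rewrite x∈⁅y⁆⇒x≡y v x∈⁅v⁆ =
    interior-mono G (p⊆p∪q ⁅ w ⁆) (∈-interior⁺ G _ v∈B blue)

  force-∣forcers∣<∣interior∣ : ∀ {B F t} → Force G (B , F) t →
                               F ⊆ interior G B → ∣ F ∣ < ∣ interior G B ∣
  force-∣forcers∣<∣interior∣ (force v _ v∈B v∉F blue _) F⊆I =
    p⊂q⇒∣p∣<∣q∣ (F⊆I , v , ∈-interior⁺ G _ v∈B blue , v∉F)

  force-∣blue∣ : ∀ {B F B′ F′} → Force G (B , F) (B′ , F′) → ∣ B′ ∣ ≡ suc ∣ B ∣
  force-∣blue∣ (force _ _ _ _ _ w∉B) = ∣p∪⁅x⁆∣≡1+∣p∣ w∉B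

  force-∣forcers∣ : ∀ {B F B′ F′} → Force G (B , F) (B′ , F′) → ∣ F′ ∣ ≡ suc ∣ F ∣
  force-∣forcers∣ (force _ _ _ v∉F _ _) = ∣p∪⁅x⁆∣≡1+∣p∣ v∉F

  -- While fewer than k vertices are blue, reaching k takes k − |B| more forces, after
  -- which a k-vertex blue set holds |F| + (k − |B|) forcers in its interior and must
  -- still offer one more.
  forces-bound : ∀ {k m} → k < n → (∀ B → ∣ B ∣ ≡ k → ∣ interior G B ∣ ≤ m) →
                 ∀ {B F F′} → Forces G (B , F) (⊤ , F′) → F ⊆ interior G B →
                 ∣ B ∣ ≤ k → k + ∣ F ∣ < ∣ B ∣ + m
  forces-bound k<n _ done _ ∣⊤∣≤k = contradiction (ℕ.≤-<-trans ∣⊤∣≤k k<n) (ℕ.<-irrefl (∣⊤∣≡n n))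
  forces-bound {k} {m} k<n small {B} {F} (step {t = B′ , F′} f rest) F⊆I ∣B∣≤k
    with ℕ.m≤n⇒m<n∨m≡n ∣B∣≤k
  ... | inj₂ refl = ℕ.+-monoʳ-< k (ℕ.<-≤-trans (force-∣forcers∣<∣interior∣ f F⊆I) (small B refl))
  ... | inj₁ ∣B∣<k = s<s⁻¹ (begin-strict
    suc (k + ∣ F ∣) ≡⟨ ℕ.+-suc k ∣ F ∣ ⟨
    k + suc ∣ F ∣   ≡⟨ cong (k +_) (force-∣forcers∣ f) ⟨
    k + ∣ F′ ∣      <⟨ forces-bound k<n small rest (forcers⊆interior-step f F⊆I) ∣B′∣≤k ⟩
    ∣ B′ ∣ + m      ≡⟨ cong (_+ m) (force-∣blue∣ f) ⟩
    suc ∣ B ∣ + m   ∎)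
    where
    open ℕ.≤-Reasoning
    ∣B′∣≤k : ∣ B′ ∣ ≤ k
    ∣B′∣≤k = subst (_≤ k) (sym (force-∣blue∣ f)) ∣B∣<k

  hoppingForcingSet-bound : ∀ {k m} → k < n → (∀ B → ∣ B ∣ ≡ k → ∣ interior G B ∣ ≤ m) →
                            ∀ B → IsHoppingForcingSet G B → ∣ B ∣ ≤ k → k < ∣ B ∣ + m
  hoppingForcingSet-bound {k} {m} k<n small B (_ , forces) ∣B∣≤k =
    subst (_< ∣ B ∣ + m) (trans (cong (k +_) (∣⊥∣≡0 n)) (ℕ.+-identityʳ k))
      (forces-bound k<n small forces ⊥⊆ ∣B∣≤k)

  decidedForce : ∀ {B F} v w → {True (v ∈? B)} → {False (v ∈? F)} → {True (nbhdBlue? G B v)} →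
                 {False (w ∈? B)} → Force G (B , F) (B ∪ ⁅ w ⁆ , F ∪ ⁅ v ⁆)
  decidedForce v w {v∈B} {v∉F} {blue} {w∉B} =
    force v w (toWitness v∈B) (toWitnessFalse v∉F) (toWitness blue) (toWitnessFalse w∉B)

petersen-∣interior∣≤2 : ∀ B → ∣ B ∣ ≡ 7 → ∣ interior Petersen B ∣ ≤ 2
petersen-∣interior∣≤2 B ∣B∣≡7 = ℕ.≮⇒≥ λ 2<∣I∣ → noLargeInterior (B , ∣B∣≡7 , 2<∣I∣)
  where
  noLargeInterior : ¬ ∃ λ B → ∣ B ∣ ≡ 7 × 2 < ∣ interior Petersen B ∣
  noLargeInterior = from-no (anySubset? λ B → ∣ B ∣ ℕ.≟ 7 ×-dec 2 <? ∣ interior Petersen B ∣)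

petersen-∣forcingSet∣≥6 : ∀ B → IsHoppingForcingSet Petersen B → 6 ≤ ∣ B ∣
petersen-∣forcingSet∣≥6 B forcing with ∣ B ∣ ≤? 7
... | yes ∣B∣≤7 = ℕ.+-cancelʳ-≤ 2 6 ∣ B ∣
  (hoppingForcingSet-bound Petersen (from-yes (7 <? 10)) petersen-∣interior∣≤2 B forcing ∣B∣≤7)
... | no ∣B∣≰7 = ℕ.≤-trans (ℕ.n≤1+n 6) (ℕ.<⇒≤ (ℕ.≰⇒> ∣B∣≰7))

outerCycle+5 : Subset 10
outerCycle+5 = inside ∷ inside ∷ inside ∷ inside ∷ inside ∷ inside ∷
               outside ∷ outside ∷ outside ∷ outside ∷ []

outerCycle+5-forcing : IsHoppingForcingSet Petersen outerCycle+5
outerCycle+5-forcing = _ ,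
  step (decidedForce Petersen (# 0) (# 6)) (
  step (decidedForce Petersen (# 1) (# 7)) (
  step (decidedForce Petersen (# 2) (# 8)) (
  step (decidedForce Petersen (# 3) (# 9)) done)))

proposition2p10 : HoppingForcingNumberIs Petersen 6
proposition2p10 = (outerCycle+5 , outerCycle+5-forcing , refl) , petersen-∣forcingSet∣≥6
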